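{- Let $\pi$ be a uniformly random permutation of $[n]$, let $k\ge 2$ and $1\le l\le k/2$, and let $j\ge 1$ with $j+2k-l-1\le n$. Let $I_{j,l,k}$ be the indicator of the event that $(\pi(j),\dots,\pi(j+k-1))$ and $(\pi(j+k-l),\dots,\pi(j+2k-l-1))$ (two windows of length $k$ overlapping in exactly $l$ positions) are order isomorphic. Then \[\mathbb{P}(I_{j,l,k}=1)\le\frac{3^k}{k!}.\]
   Context: Two sequences of distinct numbers of the same length $k$ are order isomorphic if for all $i,j\in[k]$, the $i$th entry is smaller than the $j$th entry in one sequence iff the same holds in the other. -}

module Defs where

open import Data.Nat using (ℕ; _<_; _∸_; _+_; _<?_)
open import Data.Fin using (Fin; toℕ; fromℕ<)
open import Data.Vec using (Vec; lookup)
open import Relation.Nullary using (yes; no)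
open import Relation.Binary.PropositionalEquality using (_≡_)
open import Function.Bundles using (_⇔_)

-- A permutation of [n] is represented by its one-line notation:
-- a vector σ of length n over Fin n with pairwise distinct entries
-- (an injective self-map of a finite set, hence a bijection).
-- Position p (0-based) holds the value σ(p+1) - 1.
IsPerm : ∀ {n} → Vec (Fin n) n → Set
IsPerm {n} σ = ∀ (i i′ : Fin n) → lookup σ i ≡ lookup σ i′ → i ≡ i′

-- π(p) for a 1-based position p ∈ [n] (value as a natural number; the
-- default 0 outside [n] is never used under the lemma's hypotheses).
π : ∀ {n} → Vec (Fin n) n → ℕ → ℕ
π {n} σ p with (p ∸ 1) <? n
... | yes q = toℕ (lookup σ (fromℕ< q))
... | no _  = 0

OrderIso : ℕ → (ℕ → ℕ) → (ℕ → ℕ) → Set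
OrderIso k f g = ∀ a b → a < k → b < k → ((f a < f b) ⇔ (g a < g b))

Event : ∀ {n} → Vec (Fin n) n → ℕ → ℕ → ℕ → Set
Event σ j l k = OrderIso k (λ a → π σ (j + a)) (λ a → π σ (j + (k ∸ l) + a))

module Submission where

-- A permutation with the event is determined by its values outside the second window (an
-- injective sequence of n − k values) together with the set of values it takes on the overlap
-- (a subset of the k values left over).  The overlap is order isomorphic to the first l entries
-- of the first window, which lie outside the second window; as an injective sequence is
-- determined by its order pattern and its set of values, this fixes the overlap, hence the whole
-- first window, hence the order pattern of the second window, whose set of values is the
-- complement of the outside values.  So there are at most (n! / k!) · 2^k such permutations.

open import Defs
open import Data.Nat using (ℕ; zero; suc; pred; _≤_; _<_; _+_; _*_; _∸_; _^_; _!; z≤n; s≤s; _≟_; _<?_; _≤?_)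
open import Data.Nat.Properties
open import Data.Nat.Induction using (<-rec)
open import Data.Fin as Fin using (Fin; toℕ; fromℕ<; punchOut)
open import Data.Fin.Properties
  using (any?; injective⇒≤; punchOut-injective; toℕ-injective; toℕ<n; toℕ-fromℕ<; fromℕ<-toℕ)
open import Data.Vec using (Vec; lookup; tabulate)
open import Data.Vec.Properties using (tabulate∘lookup; tabulate-cong)
open import Data.List using (List; []; _∷_; [_]; _++_; length; map; filter; concatMap; applyUpTo; upTo)
open import Data.List.Properties
  using (length-++; length-map; length-applyUpTo; length-upTo; filter-notAll; ∷-injective)
  renaming (≡-dec to List-≡-dec)
open import Data.List.Membership.Propositional using (_∈_; _∉_; find; lose)
open import Data.List.Membership.Propositional.Properties
  using (∈-map⁺; ∈-map⁻; ∈-++⁺ˡ; ∈-++⁺ʳ; ∈-filter⁺; ∈-filter⁻; ∈-concatMap⁺; ∈-concatMap⁻; ∈-applyUpTo⁺; ∈-applyUpTo⁻; ∈-upTo⁺)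
import Data.List.Membership.DecPropositional as DecMembership
open import Data.List.Relation.Binary.Subset.Propositional using (_⊆_)
open import Data.List.Relation.Unary.Any as Any using (here; there)
open import Data.List.Relation.Unary.All as All using (All)
open import Data.List.Relation.Unary.AllPairs using ([]; _∷_)
open import Data.List.Relation.Unary.Unique.Propositional using (Unique)
open import Data.List.Relation.Unary.Unique.Propositional.Properties using (applyUpTo⁺₁)
open import Data.Product using (_×_; _,_; proj₁; proj₂; ∃-syntax)
open import Data.Product.Properties using () renaming (≡-dec to ×-≡-dec)
open import Data.Sum using (_⊎_; inj₁; inj₂)
open import Function using (_∘_; id)
open import Function.Bundles using (Equivalence; mk⇔)
open import Function.Properties.Equivalence using () renaming (sym to ⇔-sym; trans to ⇔-trans)
open import Relation.Binary using (tri<; tri≈; tri>)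
open import Relation.Binary.Definitions using (DecidableEquality)
open import Relation.Binary.PropositionalEquality
  using (_≡_; _≢_; refl; sym; trans; cong; cong₂; subst; subst₂; module ≡-Reasoning)
open import Relation.Nullary using (¬_; Dec; yes; no; ¬?; contradiction)
open import Relation.Unary using (Decidable)

-- Counting with lists

module _ {A : Set} where

  length-concatMap-≤ : ∀ {B : Set} (f : A → List B) {b} xs →
    (∀ {x} → x ∈ xs → length (f x) ≤ b) → length (concatMap f xs) ≤ length xs * b
  length-concatMap-≤ f [] _ = z≤n
  length-concatMap-≤ f (x ∷ xs) bound = begin
    length (f x ++ concatMap f xs)          ≡⟨ length-++ (f x) ⟩
    length (f x) + length (concatMap f xs)  ≤⟨ +-mono-≤ (bound (here refl)) (length-concatMap-≤ f xs (bound ∘ there)) ⟩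
    _                                       ∎
    where open ≤-Reasoning

  length-filter+length-filter-¬ : ∀ {P : A → Set} (P? : Decidable P) xs →
    length (filter P? xs) + length (filter (¬? ∘ P?) xs) ≡ length xs
  length-filter+length-filter-¬ P? [] = refl
  length-filter+length-filter-¬ P? (x ∷ xs) with P? x
  ... | yes _ = cong suc (length-filter+length-filter-¬ P? xs)
  ... | no  _ = trans (+-suc _ _) (cong suc (length-filter+length-filter-¬ P? xs))

  applyUpTo-≡⇒agree : ∀ {f g : ℕ → A} m → applyUpTo f m ≡ applyUpTo g m → ∀ {t} → t < m → f t ≡ g t
  applyUpTo-≡⇒agree (suc m) eq {zero}  _         = proj₁ (∷-injective eq)
  applyUpTo-≡⇒agree (suc m) eq {suc t} (s≤s t<m) = applyUpTo-≡⇒agree m (proj₂ (∷-injective eq)) t<m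

  sublists : List A → List (List A)
  sublists []       = [ [] ]
  sublists (x ∷ xs) = map (x ∷_) (sublists xs) ++ sublists xs

  length-sublists : ∀ xs → length (sublists xs) ≡ 2 ^ length xs
  length-sublists [] = refl
  length-sublists (x ∷ xs) = begin
    length (map (x ∷_) (sublists xs) ++ sublists xs)  ≡⟨ length-++ (map (x ∷_) (sublists xs)) ⟩
    length (map (x ∷_) (sublists xs)) + length (sublists xs)
      ≡⟨ cong (_+ length (sublists xs)) (length-map (x ∷_) (sublists xs)) ⟩
    length (sublists xs) + length (sublists xs)       ≡⟨ cong (λ t → t + t) (length-sublists xs) ⟩
    2 ^ length xs + 2 ^ length xs                     ≡⟨ cong (2 ^ length xs +_) (sym (+-identityʳ _)) ⟩
    2 ^ suc (length xs)                               ∎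
    where open ≡-Reasoning

  filter∈sublists : ∀ {P : A → Set} (P? : Decidable P) xs → filter P? xs ∈ sublists xs
  filter∈sublists P? [] = here refl
  filter∈sublists P? (x ∷ xs) with P? x
  ... | yes _ = ∈-++⁺ˡ (∈-map⁺ (x ∷_) (filter∈sublists P? xs))
  ... | no  _ = ∈-++⁺ʳ (map (x ∷_) (sublists xs)) (filter∈sublists P? xs)

fallingFactorial : ℕ → ℕ → ℕ
fallingFactorial u zero    = 1
fallingFactorial u (suc m) = u * fallingFactorial (pred u) m

fallingFactorial-monoˡ-≤ : ∀ m {u v} → u ≤ v → fallingFactorial u m ≤ fallingFactorial v m
fallingFactorial-monoˡ-≤ zero    u≤v = ≤-refl
fallingFactorial-monoˡ-≤ (suc m) u≤v = *-mono-≤ u≤v (fallingFactorial-monoˡ-≤ m (pred-mono-≤ u≤v))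

fallingFactorial*[u∸m]!≡u! : ∀ u m → m ≤ u → fallingFactorial u m * (u ∸ m) ! ≡ u !
fallingFactorial*[u∸m]!≡u! u       zero    _         = +-identityʳ (u !)
fallingFactorial*[u∸m]!≡u! (suc u) (suc m) (s≤s m≤u) = begin
  suc u * fallingFactorial u m * (u ∸ m) !    ≡⟨ *-assoc (suc u) (fallingFactorial u m) ((u ∸ m) !) ⟩
  suc u * (fallingFactorial u m * (u ∸ m) !)  ≡⟨ cong (suc u *_) (fallingFactorial*[u∸m]!≡u! u m m≤u) ⟩
  suc u * u !                                 ∎
  where open ≡-Reasoning

module _ {A : Set} (_≟_ : DecidableEquality A) where

  open DecMembership _≟_ using (_∈?_; _∉?_)

  _≢?_ : (x y : A) → Dec (x ≢ y)
  x ≢? y = ¬? (x ≟ y)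

  length-filter-≢<length : ∀ {x} {xs : List A} → x ∈ xs → length (filter (x ≢?_) xs) < length xs
  length-filter-≢<length {x} {xs} x∈xs =
    filter-notAll (x ≢?_) xs (Any.map (λ x≡y x≢y → x≢y x≡y) x∈xs)

  injectiveOn⇒length≤ : ∀ {B : Set} (f : B → A) {xs ys} → Unique xs →
    (∀ {x y} → x ∈ xs → y ∈ xs → f x ≡ f y → x ≡ y) → (∀ {x} → x ∈ xs → f x ∈ ys) →
    length xs ≤ length ys
  injectiveOn⇒length≤ f {[]}     _            _     _          = z≤n
  injectiveOn⇒length≤ f {x ∷ xs} {ys} (x∉xs ∷ xs!) f-inj f[xs]⊆ys =
    ≤-trans (s≤s (injectiveOn⇒length≤ f xs! (λ x∈ y∈ → f-inj (there x∈) (there y∈)) f[xs]⊆ys-fx))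
            (length-filter-≢<length (f[xs]⊆ys (here refl)))
    where
    f[xs]⊆ys-fx : ∀ {z} → z ∈ xs → f z ∈ filter (f x ≢?_) ys
    f[xs]⊆ys-fx z∈xs = ∈-filter⁺ (f x ≢?_) (f[xs]⊆ys (there z∈xs))
      (λ fx≡fz → All.lookup x∉xs z∈xs (f-inj (here refl) (there z∈xs) fx≡fz))

  Unique-⊆⇒length≤ : ∀ {xs ys : List A} → Unique xs → xs ⊆ ys → length xs ≤ length ys
  Unique-⊆⇒length≤ xs! xs⊆ys = injectiveOn⇒length≤ id xs! (λ _ _ → id) xs⊆ys

  length+length-filter-∉≤ : ∀ {xs ys : List A} → Unique xs → xs ⊆ ys →
    length xs + length (filter (_∉? xs) ys) ≤ length ys
  length+length-filter-∉≤ {xs} {ys} xs! xs⊆ys = begin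
    length xs + length (filter (_∉? xs) ys)
      ≤⟨ +-monoˡ-≤ _ (Unique-⊆⇒length≤ xs! (λ z∈xs → ∈-filter⁺ (_∈? xs) (xs⊆ys z∈xs) z∈xs)) ⟩
    length (filter (_∈? xs) ys) + length (filter (_∉? xs) ys)
      ≡⟨ length-filter+length-filter-¬ (_∈? xs) ys ⟩
    length ys ∎
    where open ≤-Reasoning

  arrangements : List A → ℕ → List (List A)
  arrangements U zero    = [ [] ]
  arrangements U (suc m) = concatMap (λ x → map (x ∷_) (arrangements (filter (x ≢?_) U) m)) U

  length-arrangements : ∀ U m → length (arrangements U m) ≤ fallingFactorial (length U) m
  length-arrangements U zero    = ≤-refl
  length-arrangements U (suc m) = length-concatMap-≤ _ U bound
    where
    bound : ∀ {x} → x ∈ U →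
      length (map (x ∷_) (arrangements (filter (x ≢?_) U) m)) ≤ fallingFactorial (pred (length U)) m
    bound {x} x∈U = begin
      length (map (x ∷_) (arrangements (filter (x ≢?_) U) m))  ≡⟨ length-map (x ∷_) (arrangements (filter (x ≢?_) U) m) ⟩
      length (arrangements (filter (x ≢?_) U) m)               ≤⟨ length-arrangements (filter (x ≢?_) U) m ⟩
      fallingFactorial (length (filter (x ≢?_) U)) m
        ≤⟨ fallingFactorial-monoˡ-≤ m (<⇒≤pred (length-filter-≢<length x∈U)) ⟩
      fallingFactorial (pred (length U)) m                      ∎
      where open ≤-Reasoning

  ∈-arrangements⁺ : ∀ {xs U} → Unique xs → xs ⊆ U → xs ∈ arrangements U (length xs)
  ∈-arrangements⁺ {[]}     _            _        = here refl
  ∈-arrangements⁺ {x ∷ xs} {U} (x∉xs ∷ xs!) x∷xs⊆U =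
    ∈-concatMap⁺ _ (lose (x∷xs⊆U (here refl)) (∈-map⁺ (x ∷_) (∈-arrangements⁺ xs! xs⊆U-x)))
    where
    xs⊆U-x : xs ⊆ filter (x ≢?_) U
    xs⊆U-x z∈xs = ∈-filter⁺ (x ≢?_) (x∷xs⊆U (there z∈xs)) (All.lookup x∉xs z∈xs)

  ∈-arrangements⁻ : ∀ {xs} U m → xs ∈ arrangements U m → Unique xs × xs ⊆ U × length xs ≡ m
  ∈-arrangements⁻ U zero (here refl) = [] , (λ ()) , refl
  ∈-arrangements⁻ U (suc m) xs∈
    with x , x∈U , xs∈′ ← find (∈-concatMap⁻ _ {xs = U} xs∈)
    with ys , ys∈ , refl ← ∈-map⁻ (x ∷_) xs∈′
    with ys! , ys⊆U-x , refl ← ∈-arrangements⁻ (filter (x ≢?_) U) m ys∈ =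
    All.tabulate (proj₂ ∘ ∈-filter⁻ (x ≢?_) {xs = U} ∘ ys⊆U-x) ∷ ys! ,
    (λ { (here refl) → x∈U ; (there z∈ys) → proj₁ (∈-filter⁻ (x ≢?_) {xs = U} (ys⊆U-x z∈ys)) }) ,
    refl

-- Order isomorphism

module _ {d : ℕ} {f g : ℕ → ℕ} where

  OrderIso-sym : OrderIso d f g → OrderIso d g f
  OrderIso-sym f≅g a b a<d b<d = ⇔-sym (f≅g a b a<d b<d)

  OrderIso-trans : ∀ {h} → OrderIso d f g → OrderIso d g h → OrderIso d f h
  OrderIso-trans f≅g g≅h a b a<d b<d = ⇔-trans (f≅g a b a<d b<d) (g≅h a b a<d b<d)

  OrderIso-restrict : ∀ {d′} → d′ ≤ d → OrderIso d f g → OrderIso d′ f g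
  OrderIso-restrict d′≤d f≅g a b a<d′ b<d′ = f≅g a b (<-≤-trans a<d′ d′≤d) (<-≤-trans b<d′ d′≤d)

  agree⇒OrderIso : (∀ {a} → a < d → f a ≡ g a) → OrderIso d f g
  agree⇒OrderIso f≡g a b a<d b<d =
    mk⇔ (subst₂ _<_ (f≡g a<d) (f≡g b<d)) (subst₂ _<_ (sym (f≡g a<d)) (sym (f≡g b<d)))

Image⊆ : ℕ → (ℕ → ℕ) → (ℕ → ℕ) → Set
Image⊆ d f g = ∀ {a} → a < d → ∃[ b ] b < d × g b ≡ f a

orderIso∧sameImage⇒agree : ∀ {d} {f g : ℕ → ℕ} → OrderIso d f g →
  (∀ {a b} → a < d → b < d → g a ≡ g b → a ≡ b) →
  Image⊆ d f g → Image⊆ d g f → ∀ {a} → a < d → f a ≡ g a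
-- By strong induction on the value f a: if g a < f a, then g a = f b for some b with f b < f a, so
-- g b = f b = g a and b = a; if f a < g a, then f a = g b for some b, whence f b < f a and, by
-- induction, f b = g b = f a.
orderIso∧sameImage⇒agree {d} {f} {g} f≅g g-inj f⊆g g⊆f {a} a<d =
  <-rec (λ v → ∀ {a} → a < d → f a ≡ v → f a ≡ g a) step (f a) a<d refl
  where
  step : ∀ v → (∀ {w} → w < v → ∀ {a} → a < d → f a ≡ w → f a ≡ g a) →
         ∀ {a} → a < d → f a ≡ v → f a ≡ g a
  step v below {a} a<d refl with <-cmp (g a) (f a)
  ... | tri≈ _ ga≡fa _ = sym ga≡fa
  ... | tri< ga<fa _ _ =
    let b , b<d , fb≡ga = g⊆f a<d
        fb≡gb = below (subst (_< f a) (sym fb≡ga) ga<fa) b<d refl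
    in  contradiction ga<fa (<-irrefl (trans (sym fb≡ga) (cong f (g-inj b<d a<d (trans (sym fb≡gb) fb≡ga)))))
  ... | tri> _ _ fa<ga =
    let b , b<d , gb≡fa = f⊆g a<d
        fb<fa = Equivalence.from (f≅g b a b<d a<d) (subst (_< g a) (sym gb≡fa) fa<ga)
    in  contradiction (trans (below fb<fa b<d refl) gb≡fa) (<⇒≢ fb<fa)

-- Permutations in one-line notation

injective⇒surjective : ∀ {n} (f : Fin n → Fin n) → (∀ i j → f i ≡ f j → i ≡ j) → ∀ v → ∃[ i ] f i ≡ v
injective⇒surjective {suc n} f f-inj v with any? (λ i → f i Fin.≟ v)
... | yes hit  = hit
... | no  miss = contradiction (injective⇒≤ {f = f-avoiding-v} f-avoiding-v-injective) 1+n≰n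
  where
  v≢f : ∀ i → v ≢ f i
  v≢f i v≡fi = miss (i , sym v≡fi)
  f-avoiding-v : Fin (suc n) → Fin n
  f-avoiding-v i = punchOut (v≢f i)
  f-avoiding-v-injective : ∀ {i j} → f-avoiding-v i ≡ f-avoiding-v j → i ≡ j
  f-avoiding-v-injective eq = f-inj _ _ (punchOut-injective (v≢f _) (v≢f _) eq)

module _ {n : ℕ} where

  at : Vec (Fin n) n → ℕ → ℕ
  at σ i = π σ (suc i)

  at≡lookup : ∀ (σ : Vec (Fin n) n) {i} (i<n : i < n) → at σ i ≡ toℕ (lookup σ (fromℕ< i<n))
  at≡lookup σ {i} i<n with i <? n
  ... | yes _   = refl
  ... | no  i≮n = contradiction i<n i≮n

  at<n : ∀ (σ : Vec (Fin n) n) {i} → i < n → at σ i < n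
  at<n σ i<n = subst (_< n) (sym (at≡lookup σ i<n)) (toℕ<n _)

  at-injective : ∀ {σ : Vec (Fin n) n} → IsPerm σ → ∀ {i j} → i < n → j < n → at σ i ≡ at σ j → i ≡ j
  at-injective {σ} σ-perm {i} {j} i<n j<n eq = begin
    i                        ≡⟨ toℕ-fromℕ< i<n ⟨
    toℕ (fromℕ< i<n)         ≡⟨ cong toℕ (σ-perm _ _ (toℕ-injective lookups≡)) ⟩
    toℕ (fromℕ< j<n)         ≡⟨ toℕ-fromℕ< j<n ⟩
    j                        ∎
    where
    open ≡-Reasoning
    lookups≡ = trans (sym (at≡lookup σ i<n)) (trans eq (at≡lookup σ j<n))

  at-toℕ : ∀ (σ : Vec (Fin n) n) i → at σ (toℕ i) ≡ toℕ (lookup σ i)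
  at-toℕ σ i = trans (at≡lookup σ (toℕ<n i)) (cong (toℕ ∘ lookup σ) (fromℕ<-toℕ i (toℕ<n i)))

  at-surjective : ∀ {σ : Vec (Fin n) n} → IsPerm σ → ∀ {v} → v < n → ∃[ i ] i < n × at σ i ≡ v
  at-surjective {σ} σ-perm v<n =
    let i , σi≡v = injective⇒surjective (lookup σ) σ-perm (fromℕ< v<n)
    in  toℕ i , toℕ<n i , trans (at-toℕ σ i) (trans (cong toℕ σi≡v) (toℕ-fromℕ< v<n))

  at-extensional : ∀ {σ τ : Vec (Fin n) n} → (∀ {i} → i < n → at σ i ≡ at τ i) → σ ≡ τ
  at-extensional {σ} {τ} at≡ = begin
    σ                    ≡⟨ tabulate∘lookup σ ⟨
    tabulate (lookup σ)  ≡⟨ tabulate-cong lookup≗ ⟩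
    tabulate (lookup τ)  ≡⟨ tabulate∘lookup τ ⟩
    τ                    ∎
    where
    open ≡-Reasoning
    lookup≗ : ∀ i → lookup σ i ≡ lookup τ i
    lookup≗ i = toℕ-injective (trans (sym (at-toℕ σ i)) (trans (at≡ (toℕ<n i)) (at-toℕ τ i)))

module OverlappingWindows (n k l j₀ : ℕ) (l≤s : l ≤ k ∸ l) (fits : j₀ + (k ∸ l) + k ≤ n) where

  s e m : ℕ
  s = k ∸ l
  e = j₀ + s
  m = n ∸ k

  Perm : Set
  Perm = Vec (Fin n) n

  -- Positions are 0-based, so that Event σ (suc j₀) l k is, by definition, OrderIso k (first σ) (second σ).
  first second : Perm → ℕ → ℕ
  first  σ a = at σ (j₀ + a)
  second σ a = at σ (e + a)

  Outside : ℕ → Set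
  Outside i = i < e ⊎ e + k ≤ i

  e≤m : e ≤ m
  e≤m = m+n≤o⇒m≤o∸n e fits

  k≤n : k ≤ n
  k≤n = ≤-trans (m≤n+m k e) fits

  second<n : ∀ {a} → a < k → e + a < n
  second<n a<k = <-≤-trans (+-monoʳ-< e a<k) fits

  second-not-Outside : ∀ {a} → a < k → ¬ Outside (e + a)
  second-not-Outside a<k (inj₁ e+a<e) = m+n≮m _ _ e+a<e
  second-not-Outside a<k (inj₂ e+k≤e+a) = <⇒≱ a<k (+-cancelˡ-≤ e _ _ e+k≤e+a)

  second⊎Outside : ∀ i → (∃[ a ] a < k × e + a ≡ i) ⊎ Outside i
  second⊎Outside i with i <? e | e + k ≤? i
  ... | yes i<e | _        = inj₂ (inj₁ i<e)
  ... | no  _   | yes e+k≤i = inj₂ (inj₂ e+k≤i)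
  ... | no  i≮e | no  e+k≰i =
    inj₁ (i ∸ e , +-cancelˡ-< e _ _ (subst (_< e + k) (sym e+[i∸e]≡i) (≰⇒> e+k≰i)) , e+[i∸e]≡i)
    where e+[i∸e]≡i = m+[n∸m]≡n (≮⇒≥ i≮e)

  -- the t-th position outside the second window
  outside : ℕ → ℕ
  outside t with t <? e
  ... | yes _ = t
  ... | no  _ = k + t

  outside-Outside : ∀ t → Outside (outside t)
  outside-Outside t with t <? e
  ... | yes t<e = inj₁ t<e
  ... | no  t≮e = inj₂ (subst (_≤ k + t) (+-comm k e) (+-monoʳ-≤ k (≮⇒≥ t≮e)))

  outside<n : ∀ {t} → t < m → outside t < n
  outside<n {t} t<m with t <? e
  ... | yes t<e = <-≤-trans t<e (≤-trans e≤m (m∸n≤m n k))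
  ... | no  _   = subst (k + t <_) (m+[n∸m]≡n k≤n) (+-monoʳ-< k t<m)

  outside-injective : ∀ {t t′} → outside t ≡ outside t′ → t ≡ t′
  outside-injective {t} {t′} eq with t <? e | t′ <? e
  ... | yes _   | yes _    = eq
  ... | no  _   | no  _    = +-cancelˡ-≡ k _ _ eq
  ... | yes t<e | no  t′≮e = contradiction (≤-trans (≮⇒≥ t′≮e) (≤-trans (m≤n+m t′ k) (≤-reflexive (sym eq)))) (<⇒≱ t<e)
  ... | no  t≮e | yes t′<e = contradiction (≤-trans (≮⇒≥ t≮e) (≤-trans (m≤n+m t k) (≤-reflexive eq))) (<⇒≱ t′<e)

  outside-onto : ∀ {i} → i < n → Outside i → ∃[ t ] t < m × outside t ≡ i
  outside-onto {i} i<n (inj₁ i<e) = i , <-≤-trans i<e e≤m , outside[i]≡i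
    where
    outside[i]≡i : outside i ≡ i
    outside[i]≡i with i <? e
    ... | yes _   = refl
    ... | no  i≮e = contradiction i<e i≮e
  outside-onto {i} i<n (inj₂ e+k≤i) = i ∸ k , ∸-monoˡ-< i<n k≤i , outside[i∸k]≡i
    where
    k≤i = ≤-trans (m≤n+m k e) e+k≤i
    outside[i∸k]≡i : outside (i ∸ k) ≡ i
    outside[i∸k]≡i with (i ∸ k) <? e
    ... | no  _     = m+[n∸m]≡n k≤i
    ... | yes i∸k<e = contradiction (m+n≤o⇒m≤o∸n e e+k≤i) (<⇒≱ i∸k<e)

  l≤k : l ≤ k
  l≤k = ≤-trans l≤s (m∸n≤m k l)

  AgreeOutside : Perm → Perm → Set
  AgreeOutside σ τ = ∀ {i} → i < n → Outside i → at σ i ≡ at τ i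

  second-injective : ∀ {σ} → IsPerm σ → ∀ {a b} → a < k → b < k → second σ a ≡ second σ b → a ≡ b
  second-injective σ-perm a<k b<k eq = +-cancelˡ-≡ e _ _ (at-injective σ-perm (second<n a<k) (second<n b<k) eq)

  second-Image⊆ : ∀ {σ τ} → IsPerm σ → IsPerm τ → AgreeOutside σ τ → Image⊆ k (second σ) (second τ)
  second-Image⊆ {σ} {τ} σ-perm τ-perm agree-outside {a} a<k
    with i , i<n , τi≡σa ← at-surjective τ-perm (at<n σ (second<n a<k))
    with second⊎Outside i
  ... | inj₁ (b , b<k , refl) = b , b<k , τi≡σa
  ... | inj₂ i-outside =
    contradiction (subst Outside (at-injective σ-perm i<n (second<n a<k) (trans (agree-outside i<n i-outside) τi≡σa)) i-outside)
                  (second-not-Outside a<k)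

  module _ {σ τ : Perm} (σ-perm : IsPerm σ) (τ-perm : IsPerm τ)
           (σ-event : OrderIso k (first σ) (second σ)) (τ-event : OrderIso k (first τ) (second τ))
           (agree-outside : AgreeOutside σ τ) where

    first-agree-before-overlap : ∀ {a} → a < s → first σ a ≡ first τ a
    first-agree-before-overlap a<s = agree-outside (<-≤-trans j₀+a<e (≤-trans (m≤m+n e k) fits)) (inj₁ j₀+a<e)
      where j₀+a<e = +-monoʳ-< j₀ a<s

    overlap-agree : Image⊆ l (second σ) (second τ) → Image⊆ l (second τ) (second σ) →
      ∀ {a} → a < l → second σ a ≡ second τ a
    overlap-agree σ⊆τ τ⊆σ = orderIso∧sameImage⇒agree overlaps≅
      (λ a<l b<l → second-injective τ-perm (<-≤-trans a<l l≤k) (<-≤-trans b<l l≤k)) σ⊆τ τ⊆σ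
      where
      overlaps≅ : OrderIso l (second σ) (second τ)
      overlaps≅ = OrderIso-trans (OrderIso-restrict l≤k (OrderIso-sym σ-event))
        (OrderIso-trans (agree⇒OrderIso λ a<l → first-agree-before-overlap (<-≤-trans a<l l≤s))
                                      (OrderIso-restrict l≤k τ-event))

    first-agree : (∀ {a} → a < l → second σ a ≡ second τ a) → ∀ {a} → a < k → first σ a ≡ first τ a
    first-agree overlaps≡ {a} a<k with a <? s
    ... | yes a<s = first-agree-before-overlap a<s
    ... | no  a≮s = subst (λ i → at σ i ≡ at τ i) e+[a∸s]≡j₀+a (overlaps≡ a∸s<l)
      where
      s≤a = ≮⇒≥ a≮s
      a∸s<l : a ∸ s < l
      a∸s<l = subst (a ∸ s <_) (m+n∸m≡n s l) (∸-monoˡ-< (subst (a <_) (sym (m∸n+n≡m l≤k)) a<k) s≤a)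
      e+[a∸s]≡j₀+a : e + (a ∸ s) ≡ j₀ + a
      e+[a∸s]≡j₀+a = trans (+-assoc j₀ s (a ∸ s)) (cong (j₀ +_) (m+[n∸m]≡n s≤a))

    second-agree : (∀ {a} → a < k → first σ a ≡ first τ a) → ∀ {a} → a < k → second σ a ≡ second τ a
    second-agree firsts≡ = orderIso∧sameImage⇒agree seconds≅ (second-injective τ-perm)
      (second-Image⊆ σ-perm τ-perm agree-outside) (second-Image⊆ τ-perm σ-perm (λ i<n i-out → sym (agree-outside i<n i-out)))
      where
      seconds≅ : OrderIso k (second σ) (second τ)
      seconds≅ = OrderIso-trans (OrderIso-sym σ-event)
        (OrderIso-trans (agree⇒OrderIso firsts≡) τ-event)

    reconstruct : Image⊆ l (second σ) (second τ) → Image⊆ l (second τ) (second σ) → σ ≡ τ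
    reconstruct σ⊆τ τ⊆σ = at-extensional agree
      where
      seconds≡ : ∀ {a} → a < k → second σ a ≡ second τ a
      seconds≡ = second-agree (first-agree (overlap-agree σ⊆τ τ⊆σ))
      agree : ∀ {i} → i < n → at σ i ≡ at τ i
      agree {i} i<n with second⊎Outside i
      ... | inj₁ (a , a<k , refl) = seconds≡ a<k
      ... | inj₂ i-outside        = agree-outside i<n i-outside

  open DecMembership _≟_ using (_∈?_; _∉?_)

  outsideValues overlapValues : Perm → List ℕ
  outsideValues σ = applyUpTo (at σ ∘ outside) m
  overlapValues σ = applyUpTo (second σ) l

  unused : List ℕ → List ℕ
  unused vs = filter (_∉? vs) (upTo n)

  code : Perm → List ℕ × List ℕ
  code σ = outsideValues σ , filter (_∈? overlapValues σ) (unused (outsideValues σ))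

  codes : List (List ℕ × List ℕ)
  codes = concatMap (λ vs → map (vs ,_) (sublists (unused vs))) (arrangements _≟_ (upTo n) m)

  outsideValues-Unique : ∀ {σ} → IsPerm σ → Unique (outsideValues σ)
  outsideValues-Unique {σ} σ-perm = applyUpTo⁺₁ (at σ ∘ outside) m λ t<u u<m eq →
    <⇒≢ t<u (outside-injective (at-injective σ-perm (outside<n (<-trans t<u u<m)) (outside<n u<m) eq))

  outsideValues⊆upTo : ∀ σ → outsideValues σ ⊆ upTo n
  outsideValues⊆upTo σ v∈ with t , t<m , refl ← ∈-applyUpTo⁻ (at σ ∘ outside) v∈ =
    ∈-upTo⁺ (at<n σ (outside<n t<m))

  second∉outsideValues : ∀ {σ} → IsPerm σ → ∀ {a} → a < k → second σ a ∉ outsideValues σ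
  second∉outsideValues {σ} σ-perm a<k v∈ with t , t<m , eq ← ∈-applyUpTo⁻ (at σ ∘ outside) v∈ =
    second-not-Outside a<k
      (subst Outside (sym (at-injective σ-perm (second<n a<k) (outside<n t<m) eq)) (outside-Outside t))

  code∈codes : ∀ {σ} → IsPerm σ → code σ ∈ codes
  code∈codes {σ} σ-perm = ∈-concatMap⁺ _ (lose outsideValues∈
    (∈-map⁺ (outsideValues σ ,_) (filter∈sublists (_∈? overlapValues σ) (unused (outsideValues σ)))))
    where
    outsideValues∈ : outsideValues σ ∈ arrangements _≟_ (upTo n) m
    outsideValues∈ = subst (λ t → outsideValues σ ∈ arrangements _≟_ (upTo n) t)
      (length-applyUpTo (at σ ∘ outside) m)
      (∈-arrangements⁺ _≟_ (outsideValues-Unique σ-perm) (outsideValues⊆upTo σ))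

  length-codes : length codes ≤ fallingFactorial n m * 2 ^ k
  length-codes = begin
    length codes                                   ≤⟨ length-concatMap-≤ _ arrangements-m bound ⟩
    length arrangements-m * 2 ^ k                  ≤⟨ *-monoˡ-≤ (2 ^ k) (length-arrangements _≟_ (upTo n) m) ⟩
    fallingFactorial (length (upTo n)) m * 2 ^ k   ≡⟨ cong (λ u → fallingFactorial u m * 2 ^ k) (length-upTo n) ⟩
    fallingFactorial n m * 2 ^ k                   ∎
    where
    open ≤-Reasoning
    arrangements-m = arrangements _≟_ (upTo n) m
    bound : ∀ {vs} → vs ∈ arrangements-m → length (map (vs ,_) (sublists (unused vs))) ≤ 2 ^ k
    bound {vs} vs∈ with vs! , vs⊆ , length≡m ← ∈-arrangements⁻ _≟_ (upTo n) m vs∈ = begin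
      length (map (vs ,_) (sublists (unused vs)))  ≡⟨ length-map (vs ,_) (sublists (unused vs)) ⟩
      length (sublists (unused vs))                ≡⟨ length-sublists (unused vs) ⟩
      2 ^ length (unused vs)                       ≤⟨ ^-monoʳ-≤ 2 length-unused≤k ⟩
      2 ^ k                                        ∎
      where
      length-unused≤k : length (unused vs) ≤ k
      length-unused≤k = begin
        length (unused vs)           ≤⟨ m+n≤o⇒m≤o∸n _ (subst (_≤ length (upTo n)) (+-comm (length vs) _)
                                         (length+length-filter-∉≤ _≟_ vs! vs⊆)) ⟩
        length (upTo n) ∸ length vs  ≡⟨ cong₂ _∸_ (length-upTo n) length≡m ⟩
        n ∸ m                        ≡⟨ m∸[m∸n]≡n k≤n ⟩
        k                            ∎

  code≡⇒AgreeOutside : ∀ {σ τ} → code σ ≡ code τ → AgreeOutside σ τ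
  code≡⇒AgreeOutside code≡ i<n i-outside with t , t<m , refl ← outside-onto i<n i-outside =
    applyUpTo-≡⇒agree m (cong proj₁ code≡) t<m

  code≡⇒overlap-Image⊆ : ∀ {σ τ} → IsPerm σ → code σ ≡ code τ → Image⊆ l (second σ) (second τ)
  code≡⇒overlap-Image⊆ {σ} {τ} σ-perm code≡ {a} a<l =
    let b , b<l , τb≡σa = ∈-applyUpTo⁻ (second τ)
                            (proj₂ (∈-filter⁻ (_∈? overlapValues τ) {xs = unused (outsideValues τ)} in-τ))
    in  b , b<l , sym τb≡σa
    where
    a<k = <-≤-trans a<l l≤k
    in-σ : second σ a ∈ proj₂ (code σ)
    in-σ = ∈-filter⁺ (_∈? overlapValues σ)
      (∈-filter⁺ (_∉? outsideValues σ) (∈-upTo⁺ (at<n σ (second<n a<k))) (second∉outsideValues σ-perm a<k))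
      (∈-applyUpTo⁺ (second σ) a<l)
    in-τ : second σ a ∈ proj₂ (code τ)
    in-τ = subst (λ c → second σ a ∈ proj₂ c) code≡ in-σ

  code-injective : ∀ {σ τ} → IsPerm σ → IsPerm τ →
    OrderIso k (first σ) (second σ) → OrderIso k (first τ) (second τ) → code σ ≡ code τ → σ ≡ τ
  code-injective σ-perm τ-perm σ-event τ-event code≡ =
    reconstruct σ-perm τ-perm σ-event τ-event (code≡⇒AgreeOutside code≡)
      (code≡⇒overlap-Image⊆ σ-perm code≡) (code≡⇒overlap-Image⊆ τ-perm (sym code≡))

  length*k!≤2^k*n! : (L : List Perm) → Unique L →
    All (λ σ → IsPerm σ × OrderIso k (first σ) (second σ)) L → length L * k ! ≤ 2 ^ k * n !
  length*k!≤2^k*n! L L! L-perms = begin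
    length L * k !                              ≤⟨ *-monoˡ-≤ (k !) (≤-trans length-L≤length-codes length-codes) ⟩
    fallingFactorial n m * 2 ^ k * k !          ≡⟨ cong (_* k !) (*-comm (fallingFactorial n m) (2 ^ k)) ⟩
    2 ^ k * fallingFactorial n m * k !          ≡⟨ *-assoc (2 ^ k) (fallingFactorial n m) (k !) ⟩
    2 ^ k * (fallingFactorial n m * k !)        ≡⟨ cong (λ i → 2 ^ k * (fallingFactorial n m * i !)) (m∸[m∸n]≡n k≤n) ⟨
    2 ^ k * (fallingFactorial n m * (n ∸ m) !)  ≡⟨ cong (2 ^ k *_) (fallingFactorial*[u∸m]!≡u! n m (m∸n≤m n k)) ⟩
    2 ^ k * n !                                 ∎
    where
    open ≤-Reasoning
    length-L≤length-codes : length L ≤ length codes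
    length-L≤length-codes = injectiveOn⇒length≤ (×-≡-dec (List-≡-dec _≟_) (List-≡-dec _≟_)) code L!
      (λ σ∈ τ∈ → let σ-perm , σ-event = All.lookup L-perms σ∈ ; τ-perm , τ-event = All.lookup L-perms τ∈
                 in  code-injective σ-perm τ-perm σ-event τ-event)
      (λ σ∈ → code∈codes (proj₁ (All.lookup L-perms σ∈)))

lemma2p5 : (n k l j : ℕ) → 2 ≤ k → 1 ≤ l → 2 * l ≤ k → 1 ≤ j → j + 2 * k ∸ l ∸ 1 ≤ n →
    (L : List (Vec (Fin n) n)) → Unique L →
    All (λ σ → IsPerm σ × Event σ j l k) L →
    length L * k ! ≤ 3 ^ k * n !
lemma2p5 n k l (suc j₀) _ _ 2l≤k _ j+2k∸l∸1≤n L L! L-events = begin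
  length L * k !  ≤⟨ OverlappingWindows.length*k!≤2^k*n! n k l j₀ l≤k∸l fits L L! L-events ⟩
  2 ^ k * n !     ≤⟨ *-monoˡ-≤ (n !) (^-monoˡ-≤ k (s≤s (s≤s z≤n))) ⟩
  3 ^ k * n !     ∎
  where
  open ≤-Reasoning
  l+l≤k : l + l ≤ k
  l+l≤k = subst (_≤ k) (cong (l +_) (+-identityʳ l)) 2l≤k
  l≤k∸l : l ≤ k ∸ l
  l≤k∸l = m+n≤o⇒m≤o∸n l l+l≤k
  l≤k : l ≤ k
  l≤k = m+n≤o⇒m≤o l l+l≤k
  fits : j₀ + (k ∸ l) + k ≤ n
  fits = subst (_≤ n) (begin-equality
    suc j₀ + 2 * k ∸ l ∸ 1    ≡⟨ ∸-+-assoc (suc j₀ + 2 * k) l 1 ⟩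
    suc j₀ + 2 * k ∸ (l + 1)  ≡⟨ cong (suc j₀ + 2 * k ∸_) (+-comm l 1) ⟩
    j₀ + 2 * k ∸ l            ≡⟨ cong (λ t → j₀ + (k + t) ∸ l) (+-identityʳ k) ⟩
    j₀ + (k + k) ∸ l          ≡⟨ +-∸-assoc j₀ (≤-trans l≤k (m≤m+n k k)) ⟩
    j₀ + (k + k ∸ l)          ≡⟨ cong (j₀ +_) (+-∸-comm k l≤k) ⟩
    j₀ + (k ∸ l + k)          ≡⟨ +-assoc j₀ (k ∸ l) k ⟨
    j₀ + (k ∸ l) + k          ∎) j+2k∸l∸1≤n
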